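{- Let $l\geq t+3$ and let $\mathcal A\subseteq P(n,l)$ be $t$-intersecting. Let $x_1<x_2<\cdots<x_{t+1}$ be elements of $[l]$ and $y_1,\dots,y_{t+1}\in\mathbb N_0$ with $\sum_{j=1}^{t+1}y_j\leq n$. If $\mathcal A^*(x_1,\dots,x_{t+1};y_1,\dots,y_{t+1})$ contains an independent set of size at least $l-t$, then \[ \mathcal A\subseteq\bigcup_{T\subseteq[t+1],\ \vert T\vert=t}\{\mathbf u\in P(n,l): \mathbf u(x_s)=y_s \text{ for all } s\in T\}. \]
   Context: $\mathbb N_0$ is the set of non-negative integers, $[k]=\{1,\dots,k\}$, $P(n,l)=\{(x_1,\dots,x_l)\in\mathbb N_0^l : x_1+\cdots+x_l=n\}$, and $\mathbf u(i)$ is the $i$-th coordinate of $\mathbf u$. For vectors $\mathbf u,\mathbf v$ of the same length, $I(\mathbf u,\mathbf v)=\{i: \mathbf u(i)=\mathbf v(i)\}$. A family $\mathcal A\subseteq P(n,l)$ is $t$-intersecting if $\vert I(\mathbf u,\mathbf v)\vert\geq t$ for all $\mathbf u,\mathbf v\in\mathcal A$. A family $\mathcal B$ of weak compositions is independent if $I(\mathbf u,\mathbf v)=\varnothing$ for all distinct $\mathbf u,\mathbf v\in\mathcal B$. For distinct $x_1<\cdots<x_k$ in $[l]$, $R(x_1,\dots,x_k;\mathbf u)$ denotes the vector obtained from $\mathbf u$ by deleting the coordinates $x_1,\dots,x_k$. For $y_1,\dots,y_k\in\mathbb N_0$ with $\sum y_j\leq n$, $\mathcal A(x_1,\dots,x_k;y_1,\dots,y_k)=\{\mathbf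 u\in\mathcal A: \mathbf u(x_i)=y_i \text{ for all } i\}$ and $\mathcal A^*(x_1,\dots,x_k;y_1,\dots,y_k)=\{R(x_1,\dots,x_k;\mathbf u):\mathbf u\in\mathcal A(x_1,\dots,x_k;y_1,\dots,y_k)\}\subseteq P(n-\sum_j y_j,l-k)$. -}

module Defs where

open import Data.Nat using (ℕ; zero; suc; _≡ᵇ_)
open import Data.Bool using (if_then_else_)
open import Data.Fin using (Fin)
import Data.Fin.Properties as FinP
open import Data.Vec using (Vec; []; _∷_; lookup)
open import Data.Vec.Relation.Unary.Any using (any?)
open import Data.List using (List; map; filter; zip; allFin)
open import Data.List.Relation.Unary.All using (All)
open import Data.Product using (_×_; proj₁; proj₂)
open import Relation.Nullary using (¬_; ¬?)
open import Relation.Binary.PropositionalEquality using (_≡_; _≢_)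

agreements : ∀ {l} → Vec ℕ l → Vec ℕ l → ℕ
agreements [] [] = 0
agreements (a ∷ u) (b ∷ v) = if a ≡ᵇ b then suc (agreements u v) else agreements u v

TIntersecting : ∀ {l} → ℕ → (Vec ℕ l → Set) → Set
TIntersecting {l} t A = ∀ (u v : Vec ℕ l) → A u → A v → t Data.Nat.≤ agreements u v

R : ∀ {l k} → Vec (Fin l) k → Vec ℕ l → List ℕ
R {l} x u = map (lookup u)
  (filter (λ i → ¬? (any? (λ xj → i FinP.≟ xj) x)) (allFin l))

Fixes : ∀ {l k} → Vec (Fin l) k → Vec ℕ k → Vec ℕ l → Set
Fixes {k = k} x y u = ∀ (j : Fin k) → lookup u (lookup x j) ≡ lookup y j

AStar : ∀ {l k} → (Vec ℕ l → Set) → Vec (Fin l) k → Vec ℕ k → List ℕ → Set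
AStar {l} A x y w =
  Data.Product.Σ (Vec ℕ l) (λ u → A u × Fixes x y u × R x u ≡ w)

Disjoint : List ℕ → List ℕ → Set
Disjoint w w' = All (λ p → proj₁ p ≢ proj₂ p) (zip w w')

-- Suppose u ∈ 𝒜 differs from y at two coordinates x_{s₁}, x_{s₂}. Every v ∈ 𝒜(x;y)
-- agrees with u in at least t places, of which at most t − 1 lie among the x_s,
-- so u and v agree at some coordinate j_v outside x. For the independent words
-- R(x;v) these coordinates are pairwise distinct, since u(j) = v(j) = v'(j) would
-- make R(x;v) and R(x;v') agree at j. Thus x and the j_v give t + 1 + |ℬ| > l
-- distinct coordinates, a contradiction. So u differs from y at no more than one
-- index s₀, and T = [t + 1] ∖ {s₀} works.
module Submission where

open import Defs
open import Data.Bool using (T; true; false)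
open import Data.Nat using (ℕ; zero; suc; _+_; _∸_; _≤_; _<_; _≡ᵇ_; z≤n; s≤s; s≤s⁻¹)
open import Data.Nat.Properties
  using (module ≤-Reasoning; ≤-trans; ≤-reflexive; <-≤-trans; n≤1+n; +-suc; +-monoʳ-≤; m≤n+m∸n; <-irrefl; ≡ᵇ⇒≡)
  renaming (_≟_ to _≟ℕ_)
open import Data.Fin using (Fin; zero; suc; splitAt; join) renaming (_<_ to _<ᶠ_)
import Data.Fin.Properties as Finₚ
open import Data.Fin.Subset
  using (Subset; inside; outside; _∈_; _∉_; ∣_∣; ⊥; ⁅_⁆; ∁; _∪_; _-_)
open import Data.Fin.Subset.Properties
  using (_∈?_; x∈⁅x⁆; x∉⁅y⁆⇒x≢y; x∈∁p⇒x∉p; x∈p∪q⁺; x∈p∧x≢y⇒x∈p-y; x∈p⇒∣p-x∣<∣p∣;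
         ∣p∣≤∣x∷p∣; ∣⊥∣≡0; ∣∁p∣≡n∸∣p∣; ∣⁅x⁆∣≡1; drop-there)
open import Data.Vec using (Vec; []; _∷_; lookup; sum; here)
open import Data.Vec.Relation.Unary.Any using (here; there)
open import Data.Vec.Membership.Propositional using () renaming (_∈_ to _∈ᵛ_; _∉_ to _∉ᵛ_)
open import Data.Vec.Membership.Propositional.Properties using () renaming (∈-lookup to ∈ᵛ-lookup)
open import Data.List using (List; length; map)
import Data.List as List
open import Data.List.Relation.Unary.All using (All; _∷_)
import Data.List.Relation.Unary.All as All
open import Data.List.Relation.Unary.Any using () renaming (here to hereᴸ; there to thereᴸ)
open import Data.List.Relation.Unary.AllPairs using (AllPairs; _∷_)
open import Data.List.Membership.Propositional using () renaming (_∈_ to _∈ᴸ_)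
open import Data.List.Membership.Propositional.Properties using (∈-filter⁺; ∈-allFin; ∈-lookup)
open import Data.Product using (Σ; ∃-syntax; _×_; _,_; proj₁; proj₂)
open import Data.Sum using (inj₁; inj₂; [_,_]′)
open import Data.Unit using (tt)
open import Function using (_∘_)
open import Function.Definitions using (Injective)
open import Relation.Binary using (tri<; tri≈; tri>)
open import Relation.Binary.PropositionalEquality using (_≡_; _≢_; refl; sym; trans; cong; subst; subst₂; module ≡-Reasoning)
open import Relation.Nullary using (¬_; ¬?; yes; no; contradiction)
open import Relation.Nullary.Decidable using (_×-dec_; decidable-stable)
open import Relation.Unary using (Pred; Decidable)

private
  variable
    k m n : ℕ

∣p∪q∣≤∣p∣+∣q∣ : (p q : Subset n) → ∣ p ∪ q ∣ ≤ ∣ p ∣ + ∣ q ∣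
∣p∪q∣≤∣p∣+∣q∣ []            []            = z≤n
∣p∪q∣≤∣p∣+∣q∣ (inside  ∷ p) (inside  ∷ q) = s≤s (≤-trans (∣p∪q∣≤∣p∣+∣q∣ p q) (+-monoʳ-≤ ∣ p ∣ (n≤1+n ∣ q ∣)))
∣p∪q∣≤∣p∣+∣q∣ (inside  ∷ p) (outside ∷ q) = s≤s (∣p∪q∣≤∣p∣+∣q∣ p q)
∣p∪q∣≤∣p∣+∣q∣ (outside ∷ p) (inside  ∷ q) = ≤-trans (s≤s (∣p∪q∣≤∣p∣+∣q∣ p q)) (≤-reflexive (sym (+-suc ∣ p ∣ ∣ q ∣)))
∣p∪q∣≤∣p∣+∣q∣ (outside ∷ p) (outside ∷ q) = ∣p∪q∣≤∣p∣+∣q∣ p q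

∣∁⁅x⁆∣≡n : (i : Fin (suc n)) → ∣ ∁ ⁅ i ⁆ ∣ ≡ n
∣∁⁅x⁆∣≡n {n} i = trans (∣∁p∣≡n∸∣p∣ ⁅ i ⁆) (cong (suc n ∸_) (∣⁅x⁆∣≡1 i))

toSubset : Vec (Fin n) k → Subset n
toSubset []       = ⊥
toSubset (i ∷ xs) = ⁅ i ⁆ ∪ toSubset xs

∣toSubset∣≤length : (xs : Vec (Fin n) k) → ∣ toSubset xs ∣ ≤ k
∣toSubset∣≤length {n} []       = ≤-reflexive (∣⊥∣≡0 n)
∣toSubset∣≤length (i ∷ xs) = begin
  ∣ ⁅ i ⁆ ∪ toSubset xs ∣         ≤⟨ ∣p∪q∣≤∣p∣+∣q∣ ⁅ i ⁆ (toSubset xs) ⟩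
  ∣ ⁅ i ⁆ ∣ + ∣ toSubset xs ∣     ≡⟨ cong (_+ ∣ toSubset xs ∣) (∣⁅x⁆∣≡1 i) ⟩
  suc ∣ toSubset xs ∣             ≤⟨ s≤s (∣toSubset∣≤length xs) ⟩
  suc _                           ∎
  where open ≤-Reasoning

∈ᵛ⇒∈toSubset : {j : Fin n} {xs : Vec (Fin n) k} → j ∈ᵛ xs → j ∈ toSubset xs
∈ᵛ⇒∈toSubset (here refl) = x∈p∪q⁺ (inj₁ (x∈⁅x⁆ _))
∈ᵛ⇒∈toSubset (there j∈) = x∈p∪q⁺ (inj₂ (∈ᵛ⇒∈toSubset j∈))

pairwise-distinct⇒injective : {f : Fin m → Fin n} → (∀ i j → i <ᶠ j → f i ≢ f j) → Injective _≡_ _≡_ f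
pairwise-distinct⇒injective distinct {i} {j} fi≡fj with Finₚ.<-cmp i j
... | tri< i<j _ _ = contradiction fi≡fj (distinct i j i<j)
... | tri≈ _ i≡j _ = i≡j
... | tri> _ _ j<i = contradiction (sym fi≡fj) (distinct j i j<i)

disjoint-injections⇒≤ : {f : Fin m → Fin n} {g : Fin k → Fin n} →
  Injective _≡_ _≡_ f → Injective _≡_ _≡_ g → (∀ i j → f i ≢ g j) → m + k ≤ n
disjoint-injections⇒≤ {m} {k = k} {f} {g} f-inj g-inj f≢g = Finₚ.injective⇒≤ [f,g]∘splitAt-injective
  where
  [f,g]-injective : Injective _≡_ _≡_ [ f , g ]′
  [f,g]-injective {inj₁ i} {inj₁ j} e = cong inj₁ (f-inj e)
  [f,g]-injective {inj₁ i} {inj₂ j} e = contradiction e (f≢g i j)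
  [f,g]-injective {inj₂ i} {inj₁ j} e = contradiction (sym e) (f≢g j i)
  [f,g]-injective {inj₂ i} {inj₂ j} e = cong inj₂ (g-inj e)

  [f,g]∘splitAt-injective : Injective _≡_ _≡_ ([ f , g ]′ ∘ splitAt m)
  [f,g]∘splitAt-injective {a} {b} e = begin
    a                      ≡⟨ Finₚ.join-splitAt m k a ⟨
    join m k (splitAt m a) ≡⟨ cong (join m k) ([f,g]-injective {splitAt m a} {splitAt m b} e) ⟩
    join m k (splitAt m b) ≡⟨ Finₚ.join-splitAt m k b ⟩
    b                      ∎
    where open ≡-Reasoning

all-but-one : ∀ {p} {P : Pred (Fin (suc n)) p} → Decidable P →
  (∀ {i j} → i ≢ j → ¬ P i → ¬ ¬ P j) → ∃[ i ] (∀ j → j ≢ i → P j)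
all-but-one P? no-two with Finₚ.any? (¬? ∘ P?)
... | yes (i , ¬Pi) = i , λ j j≢i → decidable-stable (P? j) (no-two (j≢i ∘ sym) ¬Pi)
... | no none        = zero , λ j _ → decidable-stable (P? j) (λ ¬Pj → none (j , ¬Pj))

AllPairs-lookup : ∀ {a r} {A : Set a} {R : A → A → Set r} {xs : List A} → AllPairs R xs →
  ∀ {i j} → i <ᶠ j → R (List.lookup xs i) (List.lookup xs j)
AllPairs-lookup (Rx ∷ _)  {zero}  {suc j} _         = All.lookup Rx (∈-lookup j)
AllPairs-lookup (_ ∷ Rxs) {suc i} {suc j} (s≤s i<j) = AllPairs-lookup Rxs i<j

disjoint-map⇒≢ : ∀ {a} {A : Set a} (f g : A → ℕ) {xs : List A} →
  Disjoint (map f xs) (map g xs) → ∀ {z} → z ∈ᴸ xs → f z ≢ g z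
disjoint-map⇒≢ f g (fz≢gz ∷ _) (hereᴸ refl) = fz≢gz
disjoint-map⇒≢ f g (_ ∷ rest)  (thereᴸ z∈) = disjoint-map⇒≢ f g rest z∈

disjoint-R⇒≢ : {x : Vec (Fin n) k} {v v' : Vec ℕ n} {j : Fin n} →
  Disjoint (R x v) (R x v') → j ∉ᵛ x → lookup v j ≢ lookup v' j
disjoint-R⇒≢ {v = v} {v'} {j} R-disjoint j∉x =
  disjoint-map⇒≢ (lookup v) (lookup v') R-disjoint (∈-filter⁺ _ (∈-allFin j) j∉x)

agreements≤∣p∣ : (u v : Vec ℕ n) (p : Subset n) →
  (∀ j → lookup u j ≡ lookup v j → j ∈ p) → agreements u v ≤ ∣ p ∣
agreements≤∣p∣ []      []      []      _       = z≤n
agreements≤∣p∣ (a ∷ u) (b ∷ v) (s ∷ p) agree⊆p with a ≡ᵇ b in a≡ᵇb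
... | false = ≤-trans (agreements≤∣p∣ u v p (λ j → drop-there ∘ agree⊆p (suc j))) (∣p∣≤∣x∷p∣ s p)
... | true with agree⊆p zero (≡ᵇ⇒≡ a b (subst T (sym a≡ᵇb) tt))
...   | here = s≤s (agreements≤∣p∣ u v p (λ j → drop-there ∘ agree⊆p (suc j)))

agreement-outside : ∀ {t} (u v : Vec ℕ n) (p : Subset n) → t ≤ agreements u v → ∣ p ∣ < t →
  ∃[ j ] j ∉ p × lookup u j ≡ lookup v j
agreement-outside u v p t≤agr ∣p∣<t with Finₚ.any? (λ j → ¬? (j ∈? p) ×-dec (lookup u j ≟ℕ lookup v j))
... | yes found = found
... | no none   = contradiction (<-≤-trans (<-≤-trans ∣p∣<t t≤agr) (agreements≤∣p∣ u v p agree⊆p)) (<-irrefl refl)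
  where
  agree⊆p : ∀ j → lookup u j ≡ lookup v j → j ∈ p
  agree⊆p j uj≡vj = decidable-stable (j ∈? p) (λ j∉p → none (j , j∉p , uj≡vj))

module _ {l t} {x : Vec (Fin l) (suc t)} (x-inj : Injective _≡_ _≡_ (lookup x)) (y : Vec ℕ (suc t))
         {u : Vec ℕ l} {s₁ s₂ : Fin (suc t)} (s₁≢s₂ : s₁ ≢ s₂)
         (u≢y₁ : lookup u (lookup x s₁) ≢ lookup y s₁) (u≢y₂ : lookup u (lookup x s₂) ≢ lookup y s₂)
  where

  private
    X : Subset l
    X = toSubset x

    a b : Fin l
    a = lookup x s₁
    b = lookup x s₂

    a∈X : a ∈ X
    a∈X = ∈ᵛ⇒∈toSubset (∈ᵛ-lookup s₁ x)

    b∈X-a : b ∈ X - a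
    b∈X-a = x∈p∧x≢y⇒x∈p-y (∈ᵛ⇒∈toSubset (∈ᵛ-lookup s₂ x)) (λ b≡a → s₁≢s₂ (sym (x-inj b≡a)))

    ∣X-a-b∣<t : ∣ X - a - b ∣ < t
    ∣X-a-b∣<t = ≤-trans (x∈p⇒∣p-x∣<∣p∣ b∈X-a) (s≤s⁻¹ (<-≤-trans (x∈p⇒∣p-x∣<∣p∣ a∈X) (∣toSubset∣≤length x)))

  agreement-outside-x : {v : Vec ℕ l} → t ≤ agreements u v → Fixes x y v → ∃[ j ] j ∉ᵛ x × lookup u j ≡ lookup v j
  agreement-outside-x {v} t≤agr v-fixes with agreement-outside u v (X - a - b) t≤agr ∣X-a-b∣<t
  ... | j , j∉X-a-b , uj≡vj = j , j∉x , uj≡vj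
    where
    j≢ : ∀ s → lookup u (lookup x s) ≢ lookup y s → j ≢ lookup x s
    j≢ s u≢y refl = u≢y (trans uj≡vj (v-fixes s))

    j∉x : j ∉ᵛ x
    j∉x j∈x = j∉X-a-b (x∈p∧x≢y⇒x∈p-y (x∈p∧x≢y⇒x∈p-y (∈ᵛ⇒∈toSubset j∈x) (j≢ s₁ u≢y₁)) (j≢ s₂ u≢y₂))

  independent-bound : {A : Vec ℕ l → Set} → TIntersecting t A → A u →
    (B : List (List ℕ)) → All (AStar A x y) B → AllPairs Disjoint B → suc t + length B ≤ l
  independent-bound {A} A-int u∈A B B⊆A* B-indep = disjoint-injections⇒≤ x-inj j-injective x≢j
    where
    Bᵢ∈A* : (i : Fin (length B)) → AStar A x y (List.lookup B i)
    Bᵢ∈A* i = All.lookup B⊆A* (∈-lookup i)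

    v : Fin (length B) → Vec ℕ l
    v i = proj₁ (Bᵢ∈A* i)

    R-v : ∀ i → R x (v i) ≡ List.lookup B i
    R-v i = proj₂ (proj₂ (proj₂ (Bᵢ∈A* i)))

    witness : ∀ i → ∃[ j ] j ∉ᵛ x × lookup u j ≡ lookup (v i) j
    witness i = let (_ , v∈A , v-fixes , _) = Bᵢ∈A* i in agreement-outside-x (A-int u (v i) u∈A v∈A) v-fixes

    j : Fin (length B) → Fin l
    j i = proj₁ (witness i)

    j∉x : ∀ i → j i ∉ᵛ x
    j∉x i = proj₁ (proj₂ (witness i))

    u≡v : ∀ i → lookup u (j i) ≡ lookup (v i) (j i)
    u≡v i = proj₂ (proj₂ (witness i))

    x≢j : ∀ s i → lookup x s ≢ j i
    x≢j s i x≡j = j∉x i (subst (_∈ᵛ x) x≡j (∈ᵛ-lookup s x))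

    distinct : ∀ i i' → i <ᶠ i' → j i ≢ j i'
    distinct i i' i<i' ji≡ji' = disjoint-R⇒≢ {v = v i} {v i'} R-disjoint (j∉x i) vi≡vi'
      where
      R-disjoint : Disjoint (R x (v i)) (R x (v i'))
      R-disjoint = subst₂ Disjoint (sym (R-v i)) (sym (R-v i')) (AllPairs-lookup B-indep i<i')

      vi≡vi' : lookup (v i) (j i) ≡ lookup (v i') (j i)
      vi≡vi' = begin
        lookup (v i) (j i)   ≡⟨ u≡v i ⟨
        lookup u (j i)       ≡⟨ cong (lookup u) ji≡ji' ⟩
        lookup u (j i')      ≡⟨ u≡v i' ⟩
        lookup (v i') (j i') ≡⟨ cong (lookup (v i')) ji≡ji' ⟨
        lookup (v i') (j i)  ∎
        where open ≡-Reasoning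

    j-injective : Injective _≡_ _≡_ j
    j-injective = pairwise-distinct⇒injective distinct

lemma3p2 : (n l t : ℕ) → t + 3 ≤ l →
    (A : Vec ℕ l → Set) → (∀ u → A u → sum u ≡ n) → TIntersecting t A →
    (x : Vec (Fin l) (suc t)) →
    (∀ (i j : Fin (suc t)) → i Data.Fin.< j → lookup x i Data.Fin.< lookup x j) →
    (y : Vec ℕ (suc t)) → sum y ≤ n →
    (B : List (List ℕ)) → All (AStar A x y) B → AllPairs Disjoint B → l ∸ t ≤ length B →
    ∀ (u : Vec ℕ l) → A u →
      Σ (Subset (suc t)) (λ T → (∣ T ∣ ≡ t) ×
        (∀ (s : Fin (suc t)) → s ∈ T → lookup u (lookup x s) ≡ lookup y s))
lemma3p2 _ l t _ _ _ A-int x x-increasing y _ B B⊆A* B-indep l∸t≤∣B∣ u u∈A =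
  let s₀ , agree = all-but-one (λ s → lookup u (lookup x s) ≟ℕ lookup y s) no-two-disagreements
  in ∁ ⁅ s₀ ⁆ , ∣∁⁅x⁆∣≡n s₀ , λ s s∈T → agree s (x∉⁅y⁆⇒x≢y (x∈∁p⇒x∉p s∈T))
  where
  x-inj : Injective _≡_ _≡_ (lookup x)
  x-inj = pairwise-distinct⇒injective (λ i j i<j → Finₚ.<⇒≢ (x-increasing i j i<j))

  no-two-disagreements : ∀ {s₁ s₂} → s₁ ≢ s₂ → lookup u (lookup x s₁) ≢ lookup y s₁ →
    ¬ ¬ (lookup u (lookup x s₂) ≡ lookup y s₂)
  no-two-disagreements s₁≢s₂ u≢y₁ u≢y₂ = <-irrefl refl (begin
    suc l                ≤⟨ s≤s (m≤n+m∸n l t) ⟩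
    suc t + (l ∸ t)      ≤⟨ +-monoʳ-≤ (suc t) l∸t≤∣B∣ ⟩
    suc t + length B     ≤⟨ independent-bound x-inj y s₁≢s₂ u≢y₁ u≢y₂ A-int u∈A B B⊆A* B-indep ⟩
    l                    ∎)
    where open ≤-Reasoning
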